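{- Let $G$ be a connected $(p,q)$-graph admitting a set-ordered odd-graceful total labeling. Then $G$ admits each of the following: (1) a set-ordered odd-edge edge-magic total labeling; (2) a set-ordered odd-edge edge-difference total labeling; (3) a set-ordered odd-edge felicitous-difference total labeling; (4) a set-ordered odd-edge graceful-difference total labeling. Moreover, for $G$ these four properties are equivalent to each other.
   Context: $[a,b]=\{a,\dots,b\}$, $[1,2q-1]^o$ is the set of odd integers in $[1,2q-1]$, $\theta(S)=\{\theta(s):s\in S\}$. A map $\theta$ on a bipartite graph is set-ordered if the two colour classes can be named $X,Y$ with $\max\theta(X)<\min\theta(Y)$. A set-ordered odd-graceful total labeling of a $(p,q)$-graph $G$ is an injective map $\theta:V(G)\to[0,2q-1]$ with $\min\theta(V(G))=0$, extended to edges by $\theta(xy)=|\theta(x)-\theta(y)|$, such that $\theta(E(G))=[1,2q-1]^o$ and $G$ is bipartite with $\theta$ set-ordered. For a bipartite $(p,q)$-graph $G$, a set-ordered odd-edge $W$-magic total labeling is a map $f:V(G)\cup E(G)\to[0,2q-1]$ that is injective on $V(G)$, is set-ordered, satisfies $f(E(G))=[1,2q-1]^o$, and for some constant satisfies for every edge $uv$: edge-magic: $f(u)+f(uv)+f(v)=k_1$ ($k_1$ positive); edge-difference: $f(uv)+|f(u)-f(v)|=k_2$ ($k_2$ positive); felicitous-difference: $|f(u)+f(v)-f(uv)|=k_3$ ($k_3\ge0$); graceful-difference: $\big||f(u)-f(v)|-f(uv)\big|=k_4$ ($k_4\ge0$). -}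

module Defs where

open import Data.Nat using (ℕ; zero; suc; _+_; _*_; _<_; _≤_; ∣_-_∣)
open import Data.Fin using (Fin)
open import Data.Bool using (Bool; true; false)
open import Data.Product using (Σ; ∃; ∃-syntax; _×_; _,_; proj₁; proj₂)
open import Data.Sum using (_⊎_)
open import Relation.Binary.PropositionalEquality using (_≡_; _≢_)
open import Relation.Binary.Construct.Closure.ReflexiveTransitive using (Star)
open import Function.Definitions using (Injective)
open import Function.Bundles using (_⇔_)

SameEnds : ∀ {p} → Fin p × Fin p → Fin p × Fin p → Set
SameEnds (u , v) (u' , v') = (u ≡ u' × v ≡ v') ⊎ (u ≡ v' × v ≡ u')

record Graph (p q : ℕ) : Set where
  field
    edge     : Fin q → Fin p × Fin p
    loopless : ∀ e → proj₁ (edge e) ≢ proj₂ (edge e)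
    simple   : ∀ e e' → SameEnds (edge e) (edge e') → e ≡ e'
open Graph public

Adj : ∀ {p q} → Graph p q → Fin p → Fin p → Set
Adj G u v = ∃[ e ] SameEnds (edge G e) (u , v)

Connected : ∀ {p q} → Graph p q → Set
Connected G = ∀ u v → Star (Adj G) u v

Odd : ℕ → Set
Odd k = ∃[ m ] k ≡ suc (2 * m)

ImageIsOddRange : ∀ q → (Fin q → ℕ) → Set
ImageIsOddRange q g = ∀ k → ((∃[ e ] g e ≡ k) ⇔ (Odd k × k < 2 * q))

-- a bipartition (colouring c : V → Bool, edges join different colours)
-- for which the labels of the class 'true' (X) are all below those of
-- the class 'false' (Y): max θ(X) < min θ(Y).
SetOrdered : ∀ {p q} → Graph p q → (Fin p → ℕ) → Set
SetOrdered {p} G θ =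
  Σ (Fin p → Bool) λ c →
    (∀ e → c (proj₁ (edge G e)) ≢ c (proj₂ (edge G e))) ×
    (∀ x y → c x ≡ true → c y ≡ false → θ x < θ y)

inducedLabel : ∀ {p q} → Graph p q → (Fin p → ℕ) → Fin q → ℕ
inducedLabel G θ e = ∣ θ (proj₁ (edge G e)) - θ (proj₂ (edge G e)) ∣

OddGraceful : ∀ {p q} → Graph p q → Set
OddGraceful {p} {q} G =
  Σ (Fin p → ℕ) λ θ →
    Injective _≡_ _≡_ θ ×
    (∀ v → θ v < 2 * q) ×
    (∃[ v ] θ v ≡ 0) ×
    ImageIsOddRange q (inducedLabel G θ) ×
    SetOrdered G θ

OddEdgeTotal : ∀ {p q} → Graph p q → (ℕ → ℕ → ℕ → Set) → Set
OddEdgeTotal {p} {q} G Cond =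
  Σ (Fin p → ℕ) λ fv → Σ (Fin q → ℕ) λ fe →
    Injective _≡_ _≡_ fv ×
    (∀ v → fv v < 2 * q) ×
    (∀ e → fe e < 2 * q) ×
    SetOrdered G fv ×
    ImageIsOddRange q fe ×
    (∀ e → Cond (fv (proj₁ (edge G e))) (fe e) (fv (proj₂ (edge G e))))

EdgeMagic : ∀ {p q} → Graph p q → Set
EdgeMagic G = ∃[ k ] (0 < k × OddEdgeTotal G (λ a w b → a + w + b ≡ k))

EdgeDifference : ∀ {p q} → Graph p q → Set
EdgeDifference G = ∃[ k ] (0 < k × OddEdgeTotal G (λ a w b → w + ∣ a - b ∣ ≡ k))

FelicitousDifference : ∀ {p q} → Graph p q → Set
FelicitousDifference G = ∃[ k ] OddEdgeTotal G (λ a w b → ∣ a + b - w ∣ ≡ k)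

GracefulDifference : ∀ {p q} → Graph p q → Set
GracefulDifference G = ∃[ k ] OddEdgeTotal G (λ a w b → ∣ ∣ a - b ∣ - w ∣ ≡ k)

{-# OPTIONS --safe #-}
module Submission where

-- Let X be the lower colour class.  The edge labelled 1 joins some x ∈ X to
-- a y ∈ Y with θ(y) = θ(x) + 1, so M := θ(x) = max θ(X) < min θ(Y).  Reflecting
-- the labels of X inside [0, M] (x ↦ M − θ(x)) gives a labeling f that is
-- still injective and set-ordered, and turns the edge condition θ(y) − θ(x) = θ(xy) into
-- f(x) + f(y) − θ(xy) = M.  Together with the complementary edge labels
-- 2q − θ(xy), which again exhaust the odd numbers below 2q, this gives all four
-- labelings: (f, 2q − θ) is edge-magic with constant M + 2q, (f, θ) is
-- felicitous-difference with constant M, (θ, 2q − θ) is edge-difference with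
-- constant 2q and (θ, θ) is graceful-difference with constant 0.  Since all
-- four always hold, they are trivially equivalent.

open import Defs
open import Data.Nat using (ℕ; suc; _+_; _*_; _∸_; _<_; _≤_; ∣_-_∣; z≤n; s≤s)
open import Data.Nat.Properties
open import Data.Fin using (Fin)
open import Data.Bool using (Bool; true; false; if_then_else_)
open import Data.Product using (∃-syntax; _×_; _,_; proj₁; proj₂)
open import Data.Sum using (_⊎_; inj₁; inj₂)
open import Data.Empty using (⊥-elim)
open import Relation.Binary.PropositionalEquality
open import Relation.Nullary using (contradiction)
open import Function.Base using (_∘′_; id; const)
open import Function.Definitions using (Injective)
open import Function.Bundles using (_⇔_; mk⇔; Equivalence)
open import Data.Nat.Tactic.RingSolver using (solve-∀)

open ≡-Reasoning

∸-+-reflect : ∀ {a b M} → a ≤ M → a ≤ b → (M ∸ a) + b ≡ M + (b ∸ a)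
∸-+-reflect {a} {b} {M} a≤M a≤b = begin
  (M ∸ a) + b              ≡⟨ cong ((M ∸ a) +_) (sym (m+[n∸m]≡n a≤b)) ⟩
  (M ∸ a) + (a + (b ∸ a))  ≡⟨ sym (+-assoc (M ∸ a) a (b ∸ a)) ⟩
  (M ∸ a) + a + (b ∸ a)    ≡⟨ cong (_+ (b ∸ a)) (m∸n+n≡m a≤M) ⟩
  M + (b ∸ a)              ∎

reflect-magic : ∀ {a b M Q} → a ≤ M → a ≤ b → b ≤ Q →
                (M ∸ a) + (Q ∸ ∣ a - b ∣) + b ≡ M + Q
reflect-magic {a} {b} {M} {Q} a≤M a≤b b≤Q rewrite m≤n⇒∣m-n∣≡n∸m a≤b = begin
  (M ∸ a) + (Q ∸ d) + b    ≡⟨ +-assoc (M ∸ a) (Q ∸ d) b ⟩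
  (M ∸ a) + ((Q ∸ d) + b)  ≡⟨ cong ((M ∸ a) +_) (+-comm (Q ∸ d) b) ⟩
  (M ∸ a) + (b + (Q ∸ d))  ≡⟨ sym (+-assoc (M ∸ a) b (Q ∸ d)) ⟩
  (M ∸ a) + b + (Q ∸ d)    ≡⟨ cong (_+ (Q ∸ d)) (∸-+-reflect a≤M a≤b) ⟩
  M + d + (Q ∸ d)          ≡⟨ +-assoc M d (Q ∸ d) ⟩
  M + (d + (Q ∸ d))        ≡⟨ cong (M +_) (m+[n∸m]≡n (≤-trans (m∸n≤m b a) b≤Q)) ⟩
  M + Q                    ∎
  where d = b ∸ a

reflect-felicitous : ∀ {a b M} → a ≤ M → a ≤ b → ∣ (M ∸ a) + b - ∣ a - b ∣ ∣ ≡ M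
reflect-felicitous {a} {b} {M} a≤M a≤b rewrite m≤n⇒∣m-n∣≡n∸m a≤b = begin
  ∣ (M ∸ a) + b - d ∣  ≡⟨ cong ∣_- d ∣ (∸-+-reflect a≤M a≤b) ⟩
  ∣ M + d - d ∣        ≡⟨ m≤n⇒∣n-m∣≡n∸m (m≤n+m d M) ⟩
  M + d ∸ d            ≡⟨ m+n∸n≡m M d ⟩
  M                    ∎
  where d = b ∸ a

double-positive : ∀ {q} → 0 < 2 * q → 1 < 2 * q
double-positive {suc q} _ = *-monoʳ-≤ 2 (s≤s (z≤n {q}))

outer-swap : ∀ a w b → a + w + b ≡ b + w + a
outer-swap = solve-∀

odd-complement : ∀ q {k} → Odd k → k < 2 * q → Odd (2 * q ∸ k)
odd-complement q {k} (m , refl) k<2q = r , (begin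
  2 * q ∸ k                        ≡⟨ cong (λ n → 2 * n ∸ k) (sym (m+[n∸m]≡n m<q)) ⟩
  2 * (suc m + r) ∸ k              ≡⟨ cong (_∸ k) (double-split m r) ⟩
  suc (2 * m) + suc (2 * r) ∸ k    ≡⟨ m+n∸m≡n k (suc (2 * r)) ⟩
  suc (2 * r)                      ∎)
  where
  m<q : m < q
  m<q = *-cancelˡ-< 2 m q (<-trans (n<1+n (2 * m)) k<2q)
  r : ℕ
  r = q ∸ suc m
  double-split : ∀ m r → 2 * (suc m + r) ≡ suc (2 * m) + suc (2 * r)
  double-split = solve-∀

oddRange-bound : ∀ {q} {g : Fin q → ℕ} → ImageIsOddRange q g → ∀ e → g e < 2 * q
oddRange-bound {g = g} img e = proj₂ (Equivalence.to (img (g e)) (e , refl))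

oddRange-complement : ∀ {q} {g : Fin q → ℕ} → ImageIsOddRange q g →
                      ImageIsOddRange q (λ e → 2 * q ∸ g e)
oddRange-complement {q} {g} img k = mk⇔ to from
  where
  complement-in-range : ∀ {n} → Odd n × n < 2 * q → Odd (2 * q ∸ n) × 2 * q ∸ n < 2 * q
  complement-in-range {n} (odd@(_ , refl) , n<2q) =
    odd-complement q odd n<2q , ∸-monoʳ-< {2 * q} {n} {0} (s≤s z≤n) (<⇒≤ n<2q)
  to : ∃[ e ] 2 * q ∸ g e ≡ k → Odd k × k < 2 * q
  to (e , refl) = complement-in-range (Equivalence.to (img (g e)) (e , refl))
  from : Odd k × k < 2 * q → ∃[ e ] 2 * q ∸ g e ≡ k
  from k-in-range with Equivalence.from (img (2 * q ∸ k)) (complement-in-range k-in-range)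
  ... | e , ge≡ = e , trans (cong (2 * q ∸_) ge≡) (m∸[m∸n]≡n (<⇒≤ (proj₂ k-in-range)))

crossing : ∀ {b b' : Bool} → b ≢ b' → (b ≡ true × b' ≡ false) ⊎ (b' ≡ true × b ≡ false)
crossing {true}  {true}  b≢b' = ⊥-elim (b≢b' refl)
crossing {true}  {false} _    = inj₁ (refl , refl)
crossing {false} {true}  _    = inj₂ (refl , refl)
crossing {false} {false} b≢b' = ⊥-elim (b≢b' refl)

Separates : ∀ {p} → (Fin p → Bool) → (Fin p → ℕ) → ℕ → Set
Separates c θ M = (∀ x → c x ≡ true → θ x ≤ M) × (∀ y → c y ≡ false → M < θ y)

module Bipartition {p q} (G : Graph p q) (c : Fin p → Bool)
                   (proper : ∀ e → c (proj₁ (edge G e)) ≢ c (proj₂ (edge G e))) where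

  onEdges-byColour : (P : Fin p → Fin p → Set) → (∀ {x y} → P x y → P y x) →
                     (∀ {x y} → c x ≡ true → c y ≡ false → P x y) →
                     ∀ e → P (proj₁ (edge G e)) (proj₂ (edge G e))
  onEdges-byColour P P-sym P-crossing e with crossing (proper e)
  ... | inj₁ (cu , cv) = P-crossing cu cv
  ... | inj₂ (cv , cu) = P-sym (P-crossing cv cu)

  module _ (θ : Fin p → ℕ) where

    edgeCondition : (Cond : ℕ → ℕ → ℕ → Set) → (∀ {a w b} → Cond a w b → Cond b w a) →
                    (f : Fin p → ℕ) (h : ℕ → ℕ) →
                    (∀ {x y} → c x ≡ true → c y ≡ false → Cond (f x) (h ∣ θ x - θ y ∣) (f y)) →
                    ∀ e → Cond (f (proj₁ (edge G e))) (h (inducedLabel G θ e)) (f (proj₂ (edge G e)))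
    edgeCondition Cond Cond-sym f h = onEdges-byColour
      (λ x y → Cond (f x) (h ∣ θ x - θ y ∣) (f y))
      (λ {x} {y} → subst (λ d → Cond (f y) (h d) (f x)) (∣-∣-comm (θ x) (θ y)) ∘′ Cond-sym)

    unitEdge-separates : (∀ x y → c x ≡ true → c y ≡ false → θ x < θ y) →
                         ∀ e → inducedLabel G θ e ≡ 1 → ∃[ w ] Separates c θ (θ w)
    unitEdge-separates ordered = onEdges-byColour
      (λ x y → ∣ θ x - θ y ∣ ≡ 1 → ∃[ w ] Separates c θ (θ w))
      (λ {x} {y} P unit → P (trans (∣-∣-comm (θ x) (θ y)) unit))
      separates
      where
      separates : ∀ {x y} → c x ≡ true → c y ≡ false → ∣ θ x - θ y ∣ ≡ 1 →
                  ∃[ w ] Separates c θ (θ w)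
      separates {x} {y} cx cy unit =
        x , (λ z cz → m<1+n⇒m≤n (subst (θ z <_) θy≡1+θx (ordered z y cz cy))) ,
            (λ z cz → ordered x z cx cz)
        where
        θx≤θy : θ x ≤ θ y
        θx≤θy = <⇒≤ (ordered x y cx cy)
        θy≡1+θx : θ y ≡ suc (θ x)
        θy≡1+θx = begin
          θ y                ≡⟨ sym (m∸n+n≡m θx≤θy) ⟩
          (θ y ∸ θ x) + θ x  ≡⟨ cong (_+ θ x) (trans (sym (m≤n⇒∣m-n∣≡n∸m θx≤θy)) unit) ⟩
          suc (θ x)          ∎

module Reflection {p} (c : Fin p → Bool) (θ : Fin p → ℕ) (M : ℕ) (sep : Separates c θ M) where

  reflectLower : Fin p → ℕ
  reflectLower v = if c v then M ∸ θ v else θ v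

  reflectLower-injective : Injective _≡_ _≡_ θ → Injective _≡_ _≡_ reflectLower
  reflectLower-injective θ-injective {x} {y} eq with c x in cx | c y in cy
  ... | true  | true  = θ-injective (∸-cancelˡ-≡ (proj₁ sep x cx) (proj₁ sep y cy) eq)
  ... | true  | false = contradiction (subst (_≤ M) eq (m∸n≤m M (θ x))) (<⇒≱ (proj₂ sep y cy))
  ... | false | true  = contradiction (subst (_≤ M) (sym eq) (m∸n≤m M (θ y))) (<⇒≱ (proj₂ sep x cx))
  ... | false | false = θ-injective eq

  reflectLower-< : ∀ {n} → M < n → (∀ v → θ v < n) → ∀ v → reflectLower v < n
  reflectLower-< M<n θ<n v with c v
  ... | true  = ≤-<-trans (m∸n≤m M (θ v)) M<n
  ... | false = θ<n v

  module _ {x y} (cx : c x ≡ true) (cy : c y ≡ false) where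

    reflectLower-crossing : reflectLower x ≡ M ∸ θ x × reflectLower y ≡ θ y
    reflectLower-crossing rewrite cx | cy = refl , refl

    reflectLower-ordered : reflectLower x < reflectLower y
    reflectLower-ordered rewrite cx | cy = ≤-<-trans (m∸n≤m M (θ x)) (proj₂ sep y cy)

module FromOddGraceful {p q} (G : Graph p q) (θ : Fin p → ℕ) (θ-injective : Injective _≡_ _≡_ θ)
  (θ<2q : ∀ v → θ v < 2 * q) (zero-label : ∃[ v ] θ v ≡ 0)
  (labels : ImageIsOddRange q (inducedLabel G θ)) (c : Fin p → Bool)
  (proper : ∀ e → c (proj₁ (edge G e)) ≢ c (proj₂ (edge G e)))
  (ordered : ∀ x y → c x ≡ true → c y ≡ false → θ x < θ y) where

  open Bipartition G c proper

  complement : Fin q → ℕ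
  complement e = 2 * q ∸ inducedLabel G θ e

  complementLabels : ImageIsOddRange q complement
  complementLabels = oddRange-complement labels

  0<2q : 0 < 2 * q
  0<2q = ≤-<-trans z≤n (θ<2q (proj₁ zero-label))

  unitEdge : ∃[ e ] inducedLabel G θ e ≡ 1
  unitEdge = Equivalence.from (labels 1) ((0 , refl) , double-positive {q} 0<2q)

  separator : ∃[ w ] Separates c θ (θ w)
  separator = unitEdge-separates θ ordered (proj₁ unitEdge) (proj₂ unitEdge)

  M : ℕ
  M = θ (proj₁ separator)

  open Reflection c θ M (proj₂ separator)

  reflectLower-setOrdered : SetOrdered G reflectLower
  reflectLower-setOrdered = c , proper , λ x y → reflectLower-ordered

  module _ {x y} (cx : c x ≡ true) (cy : c y ≡ false) where

    θx≤M : θ x ≤ M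
    θx≤M = proj₁ (proj₂ separator) x cx

    θx≤θy : θ x ≤ θ y
    θx≤θy = <⇒≤ (ordered x y cx cy)

    magicCrossing : reflectLower x + (2 * q ∸ ∣ θ x - θ y ∣) + reflectLower y ≡ M + 2 * q
    magicCrossing rewrite proj₁ (reflectLower-crossing cx cy) | proj₂ (reflectLower-crossing cx cy) =
      reflect-magic θx≤M θx≤θy (<⇒≤ (θ<2q y))

    felicitousCrossing : ∣ reflectLower x + reflectLower y - ∣ θ x - θ y ∣ ∣ ≡ M
    felicitousCrossing rewrite proj₁ (reflectLower-crossing cx cy) | proj₂ (reflectLower-crossing cx cy) =
      reflect-felicitous θx≤M θx≤θy

  edgeMagic : EdgeMagic G
  edgeMagic = M + 2 * q , <-≤-trans 0<2q (m≤n+m (2 * q) M) ,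
    reflectLower , complement ,
    reflectLower-injective θ-injective , reflectLower-< (θ<2q (proj₁ separator)) θ<2q ,
    oddRange-bound complementLabels , reflectLower-setOrdered , complementLabels ,
    edgeCondition θ (λ a w b → a + w + b ≡ M + 2 * q) (λ {a} {w} {b} → trans (outer-swap b w a))
      reflectLower (2 * q ∸_) magicCrossing

  felicitousDifference : FelicitousDifference G
  felicitousDifference = M ,
    reflectLower , inducedLabel G θ ,
    reflectLower-injective θ-injective , reflectLower-< (θ<2q (proj₁ separator)) θ<2q ,
    oddRange-bound labels , reflectLower-setOrdered , labels ,
    edgeCondition θ (λ a w b → ∣ a + b - w ∣ ≡ M) (λ {a} {w} {b} → subst (λ s → ∣ s - w ∣ ≡ M) (+-comm a b))
      reflectLower id felicitousCrossing

  edgeDifference : EdgeDifference G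
  edgeDifference = 2 * q , 0<2q ,
    θ , complement , θ-injective , θ<2q , oddRange-bound complementLabels ,
    (c , proper , ordered) , complementLabels ,
    λ e → m∸n+n≡m (<⇒≤ (oddRange-bound labels e))

  gracefulDifference : GracefulDifference G
  gracefulDifference = 0 ,
    θ , inducedLabel G θ , θ-injective , θ<2q , oddRange-bound labels ,
    (c , proper , ordered) , labels ,
    λ e → ∣n-n∣≡0 (inducedLabel G θ e)

mainTheorem12 : ∀ {p q} (G : Graph p q) → Connected G → OddGraceful G →
    (EdgeMagic G × EdgeDifference G × FelicitousDifference G × GracefulDifference G) ×
    ((EdgeMagic G ⇔ EdgeDifference G) × (EdgeDifference G ⇔ FelicitousDifference G) ×
     (FelicitousDifference G ⇔ GracefulDifference G))
mainTheorem12 G _ (θ , θ-injective , θ<2q , zero-label , labels , c , proper , ordered) =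
  (edgeMagic , edgeDifference , felicitousDifference , gracefulDifference) ,
  (mk⇔ (const edgeDifference) (const edgeMagic) ,
   mk⇔ (const felicitousDifference) (const edgeDifference) ,
   mk⇔ (const gracefulDifference) (const felicitousDifference))
  where open FromOddGraceful G θ θ-injective θ<2q zero-label labels c proper ordered
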